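{- Let $A$ be an alphabet with $\mathrm{Card}(A)=k$ and let $S\subseteq A^*$ be a neutral set containing every letter of $A$. Then its factor complexity $p_n=\mathrm{Card}(S\cap A^n)$ satisfies $p_0=1$ and $p_n=n(k-\chi(S))+\chi(S)$ for every $n\ge1$.
   Context: A set $S\subseteq A^*$ is factorial if it contains all factors of its elements. For $w\in S$: $\ell_S(w)=\mathrm{Card}\{a\in A: aw\in S\}$, $r_S(w)=\mathrm{Card}\{a\in A: wa\in S\}$, $e_S(w)=\mathrm{Card}\{(a,b)\in A\times A: awb\in S\}$, $m_S(w)=e_S(w)-\ell_S(w)-r_S(w)+1$. $S$ is neutral if it is factorial and $m_S(w)=0$ for every nonempty $w\in S$; its characteristic is $\chi(S)=1-m_S(\varepsilon)$. -}

module Defs where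

open import Data.Nat using (ℕ; zero; suc)
open import Data.Bool using (Bool; true; false)
open import Data.Fin using (Fin)
open import Data.List using (List; []; _∷_; _++_; length; filter; allFin; map; concatMap; [_])
open import Data.Integer using (ℤ; +_; _-_; _+_)
open import Data.Product using (_×_)
open import Relation.Binary.PropositionalEquality using (_≡_; _≢_)
open import Relation.Nullary using (¬_)
open import Data.Bool.Properties using (T?)
open import Data.Bool using (T)

Word : ℕ → Set
Word k = List (Fin k)

Lang : ℕ → Set
Lang k = Word k → Bool

wordsOfLength : (k n : ℕ) → List (Word k)
wordsOfLength k zero = [] ∷ []
wordsOfLength k (suc n) = concatMap (λ a → map (a ∷_) (wordsOfLength k n)) (allFin k)

card : {X : Set} → (X → Bool) → List X → ℕ
card P xs = length (filter (λ x → T? (P x)) xs)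

module _ {k : ℕ} (S : Lang k) where

  Factorial : Set
  Factorial = ∀ (u v w : Word k) → S (u ++ v ++ w) ≡ true → S v ≡ true

  ℓ : Word k → ℕ
  ℓ w = card (λ a → S (a ∷ w)) (allFin k)

  r : Word k → ℕ
  r w = card (λ a → S (w ++ [ a ])) (allFin k)

  e : Word k → ℕ
  e w = card (λ (ab : Fin k × Fin k) → S (Data.Product.proj₁ ab ∷ w ++ [ Data.Product.proj₂ ab ]))
             (Data.List.cartesianProduct (allFin k) (allFin k))

  m : Word k → ℤ
  m w = + e w - + ℓ w - + r w + + 1

  Neutral : Set
  Neutral = Factorial × (∀ (w : Word k) → w ≢ [] → S w ≡ true → m w ≡ + 0)

  χ : ℤ
  χ = + 1 - m []

  p : ℕ → ℕ
  p n = card S (wordsOfLength k n)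

module Submission where

-- Write 1_S for the indicator of S and Aⁿ for the words of
-- length n.  Every word of length n+1 is uniquely a·w and uniquely w·a with
-- w ∈ Aⁿ, and every word of length n+2 is uniquely a·w·b, so summing the
-- counting functions over Aⁿ counts longer words of S:
--     Σ_{w∈Aⁿ} ℓ(w) = Σ_{w∈Aⁿ} r(w) = p(n+1),   Σ_{w∈Aⁿ} e(w) = p(n+2).
-- Neutrality says e(w) + 1_S(w) = ℓ(w) + r(w) for every nonempty w ∈ S,
-- and factoriality makes the same identity trivial (0 = 0) for w ∉ S.
-- Summing it over A^{n+1} gives the recurrence p(n+3) + p(n+1) = 2 p(n+2),
-- so (p(n+1))ₙ is an arithmetic progression of integers.  Its first terms
-- are p(1) = ℓ(ε) = k (all letters lie in S) and p(2) = e(ε) = 2k − χ(S)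
-- (unfold m(ε)), whence p(n) = n(k − χ(S)) + χ(S) for n ≥ 1; p(0) = 1
-- because ε is a factor of a letter.

open import Defs
open import Data.Nat using (ℕ; _≥_; zero; suc)
import Data.Nat as N
import Data.Nat.Properties as NP
open import Algebra.Properties.CommutativeSemigroup NP.+-commutativeSemigroup using () renaming (interchange to +-interchange)
open import Data.Bool using (Bool; true; false)
open import Data.Fin using (Fin)
import Data.Fin as F
open import Data.List using ([_]; List; []; _∷_; _++_; map; concatMap; allFin; length; cartesianProduct)
import Data.List.Properties as LP
open import Data.Integer using (ℤ; +_; _-_; _+_; _*_)
import Data.Integer.Properties as IP
open import Data.Integer.Tactic.RingSolver using (solve-∀)
open import Data.Product using (_×_; _,_)
open import Data.Empty using (⊥-elim)
open import Relation.Binary.PropositionalEquality using (_≡_; _≢_; refl; sym; trans; cong; cong₂; subst)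
open Relation.Binary.PropositionalEquality.≡-Reasoning

Σ : {X : Set} → (X → ℕ) → List X → ℕ
Σ f []       = 0
Σ f (x ∷ xs) = f x N.+ Σ f xs

Σ-cong : {X : Set} {f g : X → ℕ} → (∀ x → f x ≡ g x) → (xs : List X) → Σ f xs ≡ Σ g xs
Σ-cong h []       = refl
Σ-cong h (x ∷ xs) = cong₂ N._+_ (h x) (Σ-cong h xs)

Σ-zero : {X : Set} {f : X → ℕ} → (∀ x → f x ≡ 0) → (xs : List X) → Σ f xs ≡ 0
Σ-zero h []       = refl
Σ-zero h (x ∷ xs) = cong₂ N._+_ (h x) (Σ-zero h xs)

Σ-++ : {X : Set} (f : X → ℕ) (xs ys : List X) → Σ f (xs ++ ys) ≡ Σ f xs N.+ Σ f ys
Σ-++ f []       ys = refl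
Σ-++ f (x ∷ xs) ys = trans (cong (f x N.+_) (Σ-++ f xs ys)) (sym (NP.+-assoc (f x) _ _))

Σ-map : {X Y : Set} (f : Y → ℕ) (h : X → Y) (xs : List X) → Σ f (map h xs) ≡ Σ (λ x → f (h x)) xs
Σ-map f h []       = refl
Σ-map f h (x ∷ xs) = cong (f (h x) N.+_) (Σ-map f h xs)

Σ-concatMap : {X Y : Set} (f : Y → ℕ) (g : X → List Y) (xs : List X) →
              Σ f (concatMap g xs) ≡ Σ (λ x → Σ f (g x)) xs
Σ-concatMap f g []       = refl
Σ-concatMap f g (x ∷ xs) =
  trans (Σ-++ f (g x) (concatMap g xs)) (cong (Σ f (g x) N.+_) (Σ-concatMap f g xs))

Σ-+ : {X : Set} (f g : X → ℕ) (xs : List X) → Σ (λ x → f x N.+ g x) xs ≡ Σ f xs N.+ Σ g xs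
Σ-+ f g []       = refl
Σ-+ f g (x ∷ xs) = begin
  (f x N.+ g x) N.+ Σ (λ y → f y N.+ g y) xs ≡⟨ cong ((f x N.+ g x) N.+_) (Σ-+ f g xs) ⟩
  (f x N.+ g x) N.+ (Σ f xs N.+ Σ g xs)      ≡⟨ +-interchange (f x) (g x) (Σ f xs) (Σ g xs) ⟩
  (f x N.+ Σ f xs) N.+ (g x N.+ Σ g xs)      ∎

Σ-swap : {X Y : Set} (g : X → Y → ℕ) (xs : List X) (ys : List Y) →
         Σ (λ x → Σ (g x) ys) xs ≡ Σ (λ y → Σ (λ x → g x y) xs) ys
Σ-swap g []       ys = sym (Σ-zero (λ _ → refl) ys)
Σ-swap g (x ∷ xs) ys = trans (cong (Σ (g x) ys N.+_) (Σ-swap g xs ys))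
                             (sym (Σ-+ (g x) (λ y → Σ (λ x' → g x' y) xs) ys))

Σ-cartesianProduct : {X Y : Set} (g : X × Y → ℕ) (xs : List X) (ys : List Y) →
                     Σ g (cartesianProduct xs ys) ≡ Σ (λ x → Σ (λ y → g (x , y)) ys) xs
Σ-cartesianProduct g []       ys = refl
Σ-cartesianProduct g (x ∷ xs) ys =
  trans (Σ-++ g (map (x ,_) ys) _) (cong₂ N._+_ (Σ-map g (x ,_) ys) (Σ-cartesianProduct g xs ys))

Σ-one : {X : Set} (xs : List X) → Σ (λ _ → 1) xs ≡ length xs
Σ-one []       = refl
Σ-one (_ ∷ xs) = cong suc (Σ-one xs)

false≢true : false ≢ true
false≢true ()

ind : Bool → ℕ
ind true  = 1
ind false = 0

ind-≢true : (b : Bool) → b ≢ true → ind b ≡ 0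
ind-≢true true  b≢true = ⊥-elim (b≢true refl)
ind-≢true false _      = refl

card-Σ : {X : Set} (P : X → Bool) (xs : List X) → card P xs ≡ Σ (λ x → ind (P x)) xs
card-Σ P []       = refl
card-Σ P (x ∷ xs) with P x
... | true  = cong suc (card-Σ P xs)
... | false = card-Σ P xs

module _ {k : ℕ} where

  private
    A : List (Fin k)
    A = allFin k

    W : ℕ → List (Word k)
    W = wordsOfLength k

  Σ-extendˡ : (f : Word k → ℕ) (n : ℕ) → Σ f (W (suc n)) ≡ Σ (λ a → Σ (λ w → f (a ∷ w)) (W n)) A
  Σ-extendˡ f n = trans (Σ-concatMap f (λ a → map (a ∷_) (W n)) A)
                        (Σ-cong (λ a → Σ-map f (a ∷_) (W n)) A)

  Σ-extendʳ : (f : Word k → ℕ) (n : ℕ) → Σ f (W (suc n)) ≡ Σ (λ w → Σ (λ a → f (w ++ [ a ])) A) (W n)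
  Σ-extendʳ f zero = begin
    Σ f (W 1)                        ≡⟨ Σ-extendˡ f zero ⟩
    Σ (λ a → f [ a ] N.+ 0) A        ≡⟨ Σ-cong (λ a → NP.+-identityʳ (f [ a ])) A ⟩
    Σ (λ a → f [ a ]) A              ≡⟨ NP.+-identityʳ _ ⟨
    Σ (λ a → f [ a ]) A N.+ 0        ∎
  Σ-extendʳ f (suc n) = begin
    Σ f (W (2 N.+ n))                                              ≡⟨ Σ-extendˡ f (suc n) ⟩
    Σ (λ a → Σ (λ w → f (a ∷ w)) (W (suc n))) A                     ≡⟨ Σ-cong (λ a → Σ-extendʳ (λ w → f (a ∷ w)) n) A ⟩
    Σ (λ a → Σ (λ w → Σ (λ b → f (a ∷ w ++ [ b ])) A) (W n)) A      ≡⟨ Σ-extendˡ (λ w → Σ (λ b → f (w ++ [ b ])) A) n ⟨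
    Σ (λ w → Σ (λ b → f (w ++ [ b ])) A) (W (suc n))                ∎

  module Counting (S : Lang k) where

    𝟙 : Word k → ℕ
    𝟙 w = ind (S w)

    p-Σ : ∀ n → p S n ≡ Σ 𝟙 (W n)
    p-Σ n = card-Σ S (W n)

    ℓ-Σ : ∀ w → ℓ S w ≡ Σ (λ a → 𝟙 (a ∷ w)) A
    ℓ-Σ w = card-Σ _ A

    r-Σ : ∀ w → r S w ≡ Σ (λ a → 𝟙 (w ++ [ a ])) A
    r-Σ w = card-Σ _ A

    e-Σ : ∀ w → e S w ≡ Σ (λ a → Σ (λ b → 𝟙 (a ∷ w ++ [ b ])) A) A
    e-Σ w = trans (card-Σ _ (cartesianProduct A A)) (Σ-cartesianProduct _ A A)

    -- Global counting: summing ℓ (resp. r, e) over Aⁿ counts the words of S of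
    -- length n+1 by their first (resp. last) letter (resp. length n+2 by both).
    Σ-ℓ : ∀ n → Σ (ℓ S) (W n) ≡ p S (suc n)
    Σ-ℓ n = sym (begin
      p S (suc n)                              ≡⟨ p-Σ (suc n) ⟩
      Σ 𝟙 (W (suc n))                          ≡⟨ Σ-extendˡ 𝟙 n ⟩
      Σ (λ a → Σ (λ w → 𝟙 (a ∷ w)) (W n)) A    ≡⟨ Σ-swap (λ a w → 𝟙 (a ∷ w)) A (W n) ⟩
      Σ (λ w → Σ (λ a → 𝟙 (a ∷ w)) A) (W n)    ≡⟨ Σ-cong (λ w → sym (ℓ-Σ w)) (W n) ⟩
      Σ (ℓ S) (W n)                            ∎)

    Σ-r : ∀ n → Σ (r S) (W n) ≡ p S (suc n)
    Σ-r n = sym (begin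
      p S (suc n)                              ≡⟨ p-Σ (suc n) ⟩
      Σ 𝟙 (W (suc n))                          ≡⟨ Σ-extendʳ 𝟙 n ⟩
      Σ (λ w → Σ (λ a → 𝟙 (w ++ [ a ])) A) (W n) ≡⟨ Σ-cong (λ w → sym (r-Σ w)) (W n) ⟩
      Σ (r S) (W n)                            ∎)

    Σ-e : ∀ n → Σ (e S) (W n) ≡ p S (suc (suc n))
    Σ-e n = sym (begin
      p S (2 N.+ n)                                                 ≡⟨ p-Σ (2 N.+ n) ⟩
      Σ 𝟙 (W (2 N.+ n))                                             ≡⟨ Σ-extendˡ 𝟙 (suc n) ⟩
      Σ (λ a → Σ (λ w → 𝟙 (a ∷ w)) (W (suc n))) A                   ≡⟨ Σ-cong (λ a → Σ-extendʳ (λ w → 𝟙 (a ∷ w)) n) A ⟩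
      Σ (λ a → Σ (λ w → Σ (λ b → 𝟙 (a ∷ w ++ [ b ])) A) (W n)) A    ≡⟨ Σ-swap (λ a w → Σ (λ b → 𝟙 (a ∷ w ++ [ b ])) A) A (W n) ⟩
      Σ (λ w → Σ (λ a → Σ (λ b → 𝟙 (a ∷ w ++ [ b ])) A) A) (W n)    ≡⟨ Σ-cong (λ w → sym (e-Σ w)) (W n) ⟩
      Σ (e S) (W n)                                                 ∎)

    absent-word : Factorial S → ∀ v → S v ≢ true → (e S v ≡ 0) × (ℓ S v ≡ 0) × (r S v ≡ 0)
    absent-word fac v v∉S =
        trans (e-Σ v) (Σ-zero (λ a → Σ-zero (λ b → ind-≢true _ (λ h → v∉S (fac [ a ] v [ b ] h))) A) A)
      , trans (ℓ-Σ v) (Σ-zero (λ a → ind-≢true _ (λ h → v∉S (fac [ a ] v [] (subst (λ t → S (a ∷ t) ≡ true) (sym (LP.++-identityʳ v)) h)))) A)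
      , trans (r-Σ v) (Σ-zero (λ b → ind-≢true _ (λ h → v∉S (fac [] v [ b ] h))) A)

    neutral-in-ℕ : ∀ v → m S v ≡ + 0 → e S v N.+ 1 ≡ ℓ S v N.+ r S v
    neutral-in-ℕ v mv≡0 = IP.+-injective (begin
      + e S v + + 1                          ≡⟨ rearrange (+ e S v) (+ ℓ S v) (+ r S v) ⟩
      m S v + (+ ℓ S v + + r S v)            ≡⟨ cong (_+ (+ ℓ S v + + r S v)) mv≡0 ⟩
      + 0 + (+ ℓ S v + + r S v)              ≡⟨ IP.+-identityˡ _ ⟩
      + ℓ S v + + r S v                      ≡⟨ IP.pos-+ (ℓ S v) (r S v) ⟨
      + (ℓ S v N.+ r S v)                    ∎)
      where
      rearrange : ∀ (E L R : ℤ) → E + + 1 ≡ (E - L - R + + 1) + (L + R)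
      rearrange = solve-∀

    balance : Neutral S → ∀ a w → e S (a ∷ w) N.+ 𝟙 (a ∷ w) ≡ ℓ S (a ∷ w) N.+ r S (a ∷ w)
    balance (fac , neu) a w with S (a ∷ w) in eq
    ... | true  = neutral-in-ℕ (a ∷ w) (neu (a ∷ w) (λ ()) eq)
    ... | false with absent-word fac (a ∷ w) (λ h → false≢true (trans (sym eq) h))
    ...   | e≡0 , ℓ≡0 , r≡0 = begin
      e S (a ∷ w) N.+ 0       ≡⟨ cong (N._+ 0) e≡0 ⟩
      0                       ≡⟨ cong₂ N._+_ ℓ≡0 r≡0 ⟨
      ℓ S (a ∷ w) N.+ r S (a ∷ w) ∎

    -- Summing the balance over A^{n+1}: second differences of p vanish from n = 1 on.
    recurrence : Neutral S → ∀ n → p S (3 N.+ n) N.+ p S (1 N.+ n) ≡ p S (2 N.+ n) N.+ p S (2 N.+ n)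
    recurrence ne n = begin
      p S (3 N.+ n) N.+ p S (1 N.+ n)                     ≡⟨ cong₂ N._+_ (sym (Σ-e (suc n))) (p-Σ (suc n)) ⟩
      Σ (e S) (W (suc n)) N.+ Σ 𝟙 (W (suc n))             ≡⟨ Σ-+ (e S) 𝟙 (W (suc n)) ⟨
      Σ (λ w → e S w N.+ 𝟙 w) (W (suc n))                 ≡⟨ Σ-extendˡ _ n ⟩
      Σ (λ a → Σ (λ w → e S (a ∷ w) N.+ 𝟙 (a ∷ w)) (W n)) A
        ≡⟨ Σ-cong (λ a → Σ-cong (balance ne a) (W n)) A ⟩
      Σ (λ a → Σ (λ w → ℓ S (a ∷ w) N.+ r S (a ∷ w)) (W n)) A ≡⟨ Σ-extendˡ _ n ⟨
      Σ (λ w → ℓ S w N.+ r S w) (W (suc n))               ≡⟨ Σ-+ (ℓ S) (r S) (W (suc n)) ⟩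
      Σ (ℓ S) (W (suc n)) N.+ Σ (r S) (W (suc n))         ≡⟨ cong₂ N._+_ (Σ-ℓ (suc n)) (Σ-r (suc n)) ⟩
      p S (2 N.+ n) N.+ p S (2 N.+ n)                     ∎

    ℓ-ε : (∀ a → S [ a ] ≡ true) → ℓ S [] ≡ k
    ℓ-ε letters = trans (ℓ-Σ []) (trans (Σ-cong (λ a → cong ind (letters a)) A)
                         (trans (Σ-one A) (LP.length-tabulate (λ x → x))))

    p-1 : (∀ a → S [ a ] ≡ true) → p S 1 ≡ k
    p-1 letters = trans (sym (Σ-ℓ 0)) (trans (NP.+-identityʳ _) (ℓ-ε letters))

    χ-value : (∀ a → S [ a ] ≡ true) → χ S ≡ + 1 - (+ p S 2 - + k - + k + + 1)
    χ-value letters = begin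
      + 1 - (+ e S [] - + ℓ S [] - + r S [] + + 1) ≡⟨ cong (λ t → + 1 - (+ t - + ℓ S [] - + r S [] + + 1)) (trans (sym (NP.+-identityʳ _)) (Σ-e 0)) ⟩
      + 1 - (+ p S 2 - + ℓ S [] - + r S [] + + 1)  ≡⟨ cong₂ (λ x y → + 1 - (+ p S 2 - + x - + y + + 1)) (ℓ-ε letters) (ℓ-ε letters) ⟩
      + 1 - (+ p S 2 - + k - + k + + 1)            ∎

arithmetic : (f : ℕ → ℤ) → (∀ n → f (2 N.+ n) + f n ≡ f (1 N.+ n) + f (1 N.+ n)) →
             ∀ n → f n ≡ + n * (f 1 - f 0) + f 0
arithmetic f second-difference = progression
  where
  step : ∀ n → f (suc n) - f n ≡ f 1 - f 0
  step zero    = refl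
  step (suc n) = begin
    f (2 N.+ n) - f (1 N.+ n)                     ≡⟨ shift (f (2 N.+ n)) (f n) (f (1 N.+ n)) ⟩
    (f (2 N.+ n) + f n) - f (1 N.+ n) - f n        ≡⟨ cong (λ t → t - f (1 N.+ n) - f n) (second-difference n) ⟩
    (f (1 N.+ n) + f (1 N.+ n)) - f (1 N.+ n) - f n ≡⟨ cancel (f (1 N.+ n)) (f n) ⟩
    f (1 N.+ n) - f n                             ≡⟨ step n ⟩
    f 1 - f 0                                     ∎
    where
    shift : ∀ (X Y Z : ℤ) → X - Z ≡ (X + Y) - Z - Y
    shift = solve-∀
    cancel : ∀ (Z Y : ℤ) → (Z + Z) - Z - Y ≡ Z - Y
    cancel = solve-∀
  progression : ∀ n → f n ≡ + n * (f 1 - f 0) + f 0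
  progression zero    = initial-term (f 1 - f 0) (f 0)
    where
    initial-term : ∀ (D X : ℤ) → X ≡ + 0 * D + X
    initial-term = solve-∀
  progression (suc n) = begin
    f (suc n)                                ≡⟨ split (f (suc n)) (f n) ⟩
    (f (suc n) - f n) + f n                  ≡⟨ cong₂ _+_ (step n) (progression n) ⟩
    (f 1 - f 0) + (+ n * (f 1 - f 0) + f 0)  ≡⟨ collect (+ n) (f 1 - f 0) (f 0) ⟩
    (+ 1 + + n) * (f 1 - f 0) + f 0          ≡⟨ cong (λ t → t * (f 1 - f 0) + f 0) (IP.pos-+ 1 n) ⟨
    + suc n * (f 1 - f 0) + f 0              ∎
    where
    split : ∀ (X Y : ℤ) → X ≡ (X - Y) + Y
    split = solve-∀
    collect : ∀ (N D X : ℤ) → D + (N * D + X) ≡ (+ 1 + N) * D + X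
    collect = solve-∀

-- The progression with first term k and second term 2k − χ, re-indexed from 1.
reindex : ∀ (n : ℕ) (K P X : ℤ) → X ≡ + 1 - (P - K - K + + 1) →
          + n * (P - K) + K ≡ + suc n * (K - X) + X
reindex n K P X refl = trans (identity (+ n) K P) (cong (λ t → t * (K - X) + X) (sym (IP.pos-+ 1 n)))
  where
  identity : ∀ (N K P : ℤ) → N * (P - K) + K ≡ (+ 1 + N) * (K - (+ 1 - (P - K - K + + 1))) + (+ 1 - (P - K - K + + 1))
  identity = solve-∀

proposition2 : (k : ℕ) → k ≥ 1 → (S : Lang k) → Neutral S → (∀ (a : Fin k) → S [ a ] ≡ true)
    → (p S 0 ≡ 1) × (∀ (n : ℕ) → n ≥ 1 → + (p S n) ≡ (+ n) * ((+ k) - χ S) + χ S)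
proposition2 (suc k') _ S neutral@(factorial , _) letters = p-0 , p-positive
  where
  open Counting S
  k = suc k'

  -- ε ∈ S, being a factor of any letter.
  p-0 : p S 0 ≡ 1
  p-0 = trans (p-Σ 0) (cong (λ b → ind b N.+ 0) (factorial [] [] [ F.zero ] (letters F.zero)))

  q : ℕ → ℤ
  q n = + p S (suc n)

  q-affine : ∀ n → q n ≡ + n * (q 1 - q 0) + q 0
  q-affine = arithmetic q (λ n → begin
    q (2 N.+ n) + q n                       ≡⟨ IP.pos-+ (p S (3 N.+ n)) (p S (1 N.+ n)) ⟨
    + (p S (3 N.+ n) N.+ p S (1 N.+ n))     ≡⟨ cong +_ (recurrence neutral n) ⟩
    + (p S (2 N.+ n) N.+ p S (2 N.+ n))     ≡⟨ IP.pos-+ (p S (2 N.+ n)) (p S (2 N.+ n)) ⟩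
    q (1 N.+ n) + q (1 N.+ n)               ∎)

  p-positive : ∀ (n : ℕ) → n ≥ 1 → + (p S n) ≡ (+ n) * ((+ k) - χ S) + χ S
  p-positive (suc n) _ = begin
    q n                                ≡⟨ q-affine n ⟩
    + n * (q 1 - q 0) + q 0            ≡⟨ cong (λ t → + n * (q 1 - + t) + + t) (p-1 letters) ⟩
    + n * (q 1 - + k) + + k            ≡⟨ reindex n (+ k) (q 1) (χ S) (χ-value letters) ⟩
    + suc n * (+ k - χ S) + χ S        ∎
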